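{- Let $G$ be a connected graph and let $Y$ be a Gyárfás decomposition of $G$. Let $B$ be a bag of $Y$ with level $i>1$. Then $\operatorname{sind}(G[B])<\operatorname{sind}(G)$.
   Context: The strong index $\operatorname{sind}(G)$ is the maximum $k$ such that $G$ contains distinct vertices $a_1,\dots,a_k,b_1,\dots,b_k$ with: for all $1\le i<j\le k$, $a_i$ adjacent to $b_j$ and $b_i$ not adjacent to $a_j$; $a_1,\dots,a_k$ a clique; $b_1,\dots,b_k$ an independent set. A Gyárfás decomposition of a connected graph $G$ is a rooted tree $Y$ such that: (1) the nodes (bags) are pairwise disjoint non-empty subsets of $V(G)$ with union $V(G)$; (2) the root bag is a single vertex; (3) if $u\in B$, $u'\in B'$ are adjacent then one of $B,B'$ is an ancestor of the other (each node is its own ancestor); (4) for every bag $B$, the union of $B$ and its descendants induces a connected subgraph; (5) every non-root bag $B$ has a hook $h(B)$ in its parent bag adjacent to all vertices of $B$ and non-adjacent to all vertices in strict descendants of $B$. The level of a bag is the number of edges on the path in $Y$ to the root. -}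

module Defs where

open import Data.Nat using (ℕ; zero; suc; _≤_; _<_)
open import Data.Fin using (Fin)
import Data.Fin as F
open import Data.Sum using (_⊎_; inj₁; inj₂)
open import Data.Product using (Σ; _×_; ∃; proj₁)
open import Data.Empty using (⊥)
open import Function.Definitions using (Injective)
open import Relation.Nullary using (¬_)
open import Relation.Binary.PropositionalEquality using (_≡_; _≢_)

record Graph (V : Set) : Set₁ where
  field
    Adj    : V → V → Set
    sym    : ∀ {u v} → Adj u v → Adj v u
    irrefl : ∀ {u} → ¬ Adj u u
open Graph public

FinGraph : ℕ → Set₁
FinGraph n = Graph (Fin n)

induced : ∀ {V} → Graph V → (P : V → Set) → Graph (Σ V P)
induced G P = record
  { Adj    = λ u v → Adj G (proj₁ u) (proj₁ v)
  ; sym    = sym G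
  ; irrefl = irrefl G }

data Reach {V : Set} (G : Graph V) (u : V) : V → Set where
  here : Reach G u u
  step : ∀ {w v} → Reach G u w → Adj G w v → Reach G u v

Connected : ∀ {V} → Graph V → Set
Connected {V} G = (u v : V) → Reach G u v

record StrongConfig {V : Set} (G : Graph V) (k : ℕ) : Set where
  field
    a b      : Fin k → V
    distinct : Injective _≡_ _≡_ (λ (x : Fin k ⊎ Fin k) → Data.Sum.[ a , b ] x)
    ab       : ∀ i j → i F.< j → Adj G (a i) (b j)
    ba       : ∀ i j → i F.< j → ¬ Adj G (b i) (a j)
    clique   : ∀ i j → i ≢ j → Adj G (a i) (a j)
    indep    : ∀ i j → ¬ Adj G (b i) (b j)

IsSind : ∀ {V} → Graph V → ℕ → Set
IsSind G s = StrongConfig G s × (∀ k → StrongConfig G k → k ≤ s)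

data Anc {m : ℕ} (par : Fin m → Fin m) (x : Fin m) : Fin m → Set where
  self : Anc par x x
  up   : ∀ {y} → Anc par x (par y) → Anc par x y

-- Gyárfás decomposition of G.  Bags are the nodes Fin m of a rooted tree
-- (root, parent map, level = depth); bag v is the bag containing vertex v.
record Gyarfas {n : ℕ} (G : FinGraph n) : Set₁ where
  field
    m        : ℕ
    root     : Fin m
    parent   : Fin m → Fin m
    parent-root : parent root ≡ root
    level    : Fin m → ℕ
    level-root : level root ≡ 0
    level-parent : ∀ x → x ≢ root → level x ≡ suc (level (parent x))
    bag      : Fin n → Fin m
    -- (1) bags non-empty (disjointness/cover are built into `bag`)
    nonempty : ∀ x → ∃ λ v → bag v ≡ x
    root-single : ∃ λ v → bag v ≡ root × (∀ w → bag w ≡ root → w ≡ v)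
    edges    : ∀ u v → Adj G u v → Anc parent (bag u) (bag v) ⊎ Anc parent (bag v) (bag u)
    conn     : ∀ x → Connected (induced G (λ v → Anc parent x (bag v)))
    hook     : ∀ x → x ≢ root → Fin n
    hook-in  : ∀ x (p : x ≢ root) → bag (hook x p) ≡ parent x
    hook-adj : ∀ x (p : x ≢ root) v → bag v ≡ x → Adj G (hook x p) v
    hook-non : ∀ x (p : x ≢ root) v → Anc parent x (bag v) → bag v ≢ x → ¬ Adj G (hook x p) v

InBag : ∀ {n} {G : FinGraph n} (Y : Gyarfas G) → Fin (Gyarfas.m Y) → Fin n → Set
InBag Y x v = Gyarfas.bag Y v ≡ x

{-# OPTIONS --safe #-}
-- Since the bag x has level at least 2, its parent p is not the root, so both x and p
-- have hooks.  The hook of x lies in p and is adjacent to every vertex of x; the hook of p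
-- lies in the parent of p and is adjacent to no vertex of x, x being a strict descendant
-- of p.  Prepending these two vertices as a₀ and b₀ to a strong configuration of G[x]
-- yields a strong configuration of G that is one larger.  Distinctness of all the
-- vertices involved follows from the bags containing them having different levels.
module Submission where

open import Defs hiding (sym)
open import Data.Nat using (suc; _<_; z<s; s<s; s<s⁻¹)
open import Data.Nat.Properties using (<⇒≢; <-trans; n<1+n)
open import Data.Fin using (Fin; zero; suc)
import Data.Fin.Properties as Fin
open import Data.Vec.Functional using (_∷_)
open import Data.Sum using (_⊎_; inj₁; inj₂; [_,_])
import Data.Sum as Sum
open import Data.Sum.Properties using ([,]-∘)
open import Data.Product using (Σ; _,_; proj₁; proj₂)
open import Data.Empty using (⊥-elim)
open import Function using (_∘_)
open import Relation.Nullary using (¬_)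
open import Relation.Unary using (Irrelevant)
open import Relation.Binary.PropositionalEquality
  using (_≡_; _≢_; refl; sym; trans; cong; subst)
open import Axiom.UniquenessOfIdentityProofs using (module Decidable⇒UIP)

module _ {V : Set} {G : Graph V} where

  vertex : ∀ {k} → StrongConfig G k → Fin k ⊎ Fin k → V
  vertex C = [ StrongConfig.a C , StrongConfig.b C ]

  prepend : ∀ {k} (C : StrongConfig G k) (h h′ : V) → h ≢ h′
          → (∀ z → h ≢ vertex C z) → (∀ z → h′ ≢ vertex C z)
          → (∀ z → Adj G h (vertex C z)) → (∀ z → ¬ Adj G h′ (vertex C z))
          → StrongConfig G (suc k)
  prepend {k} C h h′ h≢h′ h-fresh h′-fresh h-adj h′-nonadj = record
    { a = h ∷ C.a ; b = h′ ∷ C.b ; distinct = distinct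
    ; ab = ab ; ba = ba ; clique = clique ; indep = indep }
    where
    module C = StrongConfig C

    distinct : ∀ {u w} → [ h ∷ C.a , h′ ∷ C.b ] u ≡ [ h ∷ C.a , h′ ∷ C.b ] w → u ≡ w
    distinct {inj₁ zero}    {inj₁ zero}    _ = refl
    distinct {inj₁ zero}    {inj₂ zero}    e = ⊥-elim (h≢h′ e)
    distinct {inj₁ zero}    {inj₁ (suc j)} e = ⊥-elim (h-fresh (inj₁ j) e)
    distinct {inj₁ zero}    {inj₂ (suc j)} e = ⊥-elim (h-fresh (inj₂ j) e)
    distinct {inj₂ zero}    {inj₁ zero}    e = ⊥-elim (h≢h′ (sym e))
    distinct {inj₂ zero}    {inj₂ zero}    _ = refl
    distinct {inj₂ zero}    {inj₁ (suc j)} e = ⊥-elim (h′-fresh (inj₁ j) e)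
    distinct {inj₂ zero}    {inj₂ (suc j)} e = ⊥-elim (h′-fresh (inj₂ j) e)
    distinct {inj₁ (suc i)} {inj₁ zero}    e = ⊥-elim (h-fresh (inj₁ i) (sym e))
    distinct {inj₁ (suc i)} {inj₂ zero}    e = ⊥-elim (h′-fresh (inj₁ i) (sym e))
    distinct {inj₂ (suc i)} {inj₁ zero}    e = ⊥-elim (h-fresh (inj₂ i) (sym e))
    distinct {inj₂ (suc i)} {inj₂ zero}    e = ⊥-elim (h′-fresh (inj₂ i) (sym e))
    distinct {inj₁ (suc i)} {inj₁ (suc j)} e = cong (Sum.map suc suc) (C.distinct {inj₁ i} {inj₁ j} e)
    distinct {inj₁ (suc i)} {inj₂ (suc j)} e = cong (Sum.map suc suc) (C.distinct {inj₁ i} {inj₂ j} e)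
    distinct {inj₂ (suc i)} {inj₁ (suc j)} e = cong (Sum.map suc suc) (C.distinct {inj₂ i} {inj₁ j} e)
    distinct {inj₂ (suc i)} {inj₂ (suc j)} e = cong (Sum.map suc suc) (C.distinct {inj₂ i} {inj₂ j} e)

    ab : ∀ i j → i Data.Fin.< j → Adj G ((h ∷ C.a) i) ((h′ ∷ C.b) j)
    ab zero    (suc j) _       = h-adj (inj₂ j)
    ab (suc i) (suc j) (s<s q) = C.ab i j q

    ba : ∀ i j → i Data.Fin.< j → ¬ Adj G ((h′ ∷ C.b) i) ((h ∷ C.a) j)
    ba zero    (suc j) _       = h′-nonadj (inj₁ j)
    ba (suc i) (suc j) (s<s q) = C.ba i j q

    clique : ∀ i j → i ≢ j → Adj G ((h ∷ C.a) i) ((h ∷ C.a) j)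
    clique zero    zero    i≢j = ⊥-elim (i≢j refl)
    clique zero    (suc j) _   = h-adj (inj₁ j)
    clique (suc i) zero    _   = Graph.sym G (h-adj (inj₁ i))
    clique (suc i) (suc j) i≢j = C.clique i j (i≢j ∘ cong suc)

    indep : ∀ i j → ¬ Adj G ((h′ ∷ C.b) i) ((h′ ∷ C.b) j)
    indep zero    zero    = Graph.irrefl G
    indep zero    (suc j) = h′-nonadj (inj₂ j)
    indep (suc i) zero    = h′-nonadj (inj₂ i) ∘ Graph.sym G
    indep (suc i) (suc j) = C.indep i j

module _ {V : Set} {G : Graph V} {P : V → Set} (P-irrelevant : Irrelevant P) where

  proj₁-injective : {u w : Σ V P} → proj₁ u ≡ proj₁ w → u ≡ w
  proj₁-injective {v , p} {.v , q} refl = cong (v ,_) (P-irrelevant p q)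

  forgetInduced : ∀ {k} → StrongConfig (induced G P) k → StrongConfig G k
  forgetInduced C = record
    { a = proj₁ ∘ a ; b = proj₁ ∘ b
    ; distinct = λ {u} {w} e →
        distinct (proj₁-injective (trans ([,]-∘ proj₁ u) (trans e (sym ([,]-∘ proj₁ w)))))
    ; ab = ab ; ba = ba ; clique = clique ; indep = indep }
    where open StrongConfig C

  vertex-forgetInduced : ∀ {k} (C : StrongConfig (induced G P) k) z →
                         P (vertex (forgetInduced C) z)
  vertex-forgetInduced C (inj₁ i) = proj₂ (StrongConfig.a C i)
  vertex-forgetInduced C (inj₂ i) = proj₂ (StrongConfig.b C i)

  prependInduced : ∀ {k} → StrongConfig (induced G P) k → (h h′ : V) → h ≢ h′
                 → ¬ P h → ¬ P h′
                 → (∀ {v} → P v → Adj G h v) → (∀ {v} → P v → ¬ Adj G h′ v)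
                 → StrongConfig G (suc k)
  prependInduced {k} C h h′ h≢h′ h∉P h′∉P h-adj h′-nonadj =
    prepend C′ h h′ h≢h′
      (λ z e → h∉P (subst P (sym e) (inP z)))
      (λ z e → h′∉P (subst P (sym e) (inP z)))
      (h-adj ∘ inP) (h′-nonadj ∘ inP)
    where
    C′ : StrongConfig G k
    C′ = forgetInduced C
    inP : ∀ z → P (vertex C′ z)
    inP = vertex-forgetInduced C

module _ {n} {G : FinGraph n} (Y : Gyarfas G) where
  open Gyarfas Y

  InBag-irrelevant : ∀ {x} → Irrelevant (InBag Y x)
  InBag-irrelevant = Decidable⇒UIP.≡-irrelevant Fin._≟_

  level-<⇒≢ : ∀ {x y} → level x < level y → x ≢ y
  level-<⇒≢ lt = <⇒≢ lt ∘ cong level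

  positive-level⇒≢root : ∀ {x} → 0 < level x → x ≢ root
  positive-level⇒≢root 0<level refl = <⇒≢ 0<level (sym level-root)

  level-parent-< : ∀ {x} → x ≢ root → level (parent x) < level x
  level-parent-< {x} x≢root =
    subst (level (parent x) <_) (sym (level-parent x x≢root)) (n<1+n _)

  extendBagConfig : ∀ {x k} → 1 < level x →
                    StrongConfig (induced G (InBag Y x)) k → StrongConfig G (suc k)
  extendBagConfig {x} 1<level C =
    prependInduced InBag-irrelevant C (hook x x≢root) (hook p p≢root)
      hooks-distinct
      (λ e → level-<⇒≢ p<x (trans (sym (hook-in x x≢root)) e))
      (λ e → level-<⇒≢ (<-trans pp<p p<x) (trans (sym (hook-in p p≢root)) e))
      (λ {v} → hook-adj x x≢root v)
      (λ {v} e → hook-non p p≢root v (subst (Anc parent p) (sym e) (up self))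
                                     (λ e′ → level-<⇒≢ p<x (trans (sym e′) e)))
    where
    x≢root : x ≢ root
    x≢root = positive-level⇒≢root (<-trans z<s 1<level)
    p : Fin m
    p = parent x
    p≢root : p ≢ root
    p≢root = positive-level⇒≢root (s<s⁻¹ (subst (1 <_) (level-parent x x≢root) 1<level))
    p<x : level p < level x
    p<x = level-parent-< x≢root
    pp<p : level (parent p) < level p
    pp<p = level-parent-< p≢root
    hooks-distinct : hook x x≢root ≢ hook p p≢root
    hooks-distinct e = level-<⇒≢ pp<p
      (trans (sym (hook-in p p≢root)) (trans (cong bag (sym e)) (hook-in x x≢root)))

lemma4p4 : ∀ {n} (G : FinGraph n) → Connected G → (Y : Gyarfas G)
           → (x : Fin (Gyarfas.m Y)) → 1 < Gyarfas.level Y x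
           → ∀ s t → IsSind (induced G (InBag Y x)) s → IsSind G t → s < t
lemma4p4 G _ Y x 1<level s t (C , _) (_ , maximal) =
  maximal (suc s) (extendBagConfig Y 1<level C)
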